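{- Let $j\ge 1$, let $(k_1,\dots,k_j)$ be positive integers with $K=k_1+\dots+k_j$, and let $(a_1,\dots,a_j)$ be nonnegative integers with $a_1+\dots+a_i\le k_1+\dots+k_i$ for every $1\le i\le j$; put $A=a_1+\dots+a_j$. Let $l,m$ be positive integers. Consider the $(k_1,\dots,k_j,l)$-Dyck path $D_l=N^{k_1}E^{a_1}\cdots N^{k_j}E^{a_j}N^{l}E^{K+l-A}$ and the $(k_1,\dots,k_j,m)$-Dyck path $D_m=N^{k_1}E^{a_1}\cdots N^{k_j}E^{a_j}N^{m}E^{K+m-A}$. Then $\mathrm{area}(D_l)=\mathrm{area}(D_m)$ and $\mathrm{bounce}(D_l)=\mathrm{bounce}(D_m)$.
   Context: Let $\vec k=(k_1,\dots,k_n)$ be a vector of positive integers and $K'=k_1+\dots+k_n$. A $\vec k$-Dyck path is a lattice path from $(0,0)$ to $(K',K')$ of the form $N^{k_1}E^{a_1}N^{k_2}E^{a_2}\cdots N^{k_n}E^{a_n}$, where $N=(0,1)$, $E=(1,0)$, the $a_i$ are nonnegative integers summing to $K'$, and the path never goes below $y=x$ (equivalently $a_1+\dots+a_i\le k_1+\dots+k_i$ for all $i$). The segment $N^{k_j}$ is the $j$-th north step; consecutive north steps are counted separately. The red ranks are $r_j=\sum_{i<j}(k_i-a_i)$ and $\mathrm{area}(D)=r_1+\dots+r_n$. Bounce (Xin–Zhang algorithm): let $R$ be an initially empty diagram with columns $1,\dots,n$, column $j$ having $k_j+1$ cells. Set $i=0$, $P_0=(0,0)$. While $P_i\neq(K',K')$: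 (1) let $Q_i$ be the starting point of the unique east step of $D$ starting at the $x$-coordinate of $P_i$; the $y$-coordinate of $P_i$ is $k_1+\dots+k_s$ and that of $Q_i$ is $k_1+\dots+k_{s+v_i}$ for some $v_i\ge0$; (2) fill the leftmost $v_i$ unfilled columns of $R$, column $j$ receiving entries $i,i+1,\dots,i+k_j$ from top to bottom; (3) let $h_i$ be the number of filled cells of $R$ containing $i+1$ and set $P_{i+1}=(x(Q_i)+h_i,y(Q_i))$; (4) increase $i$ by 1. Then $\mathrm{bounce}(D)=\sum_{i\ge0} i\,v_i$. -}

module Defs where

open import Data.Nat using (ℕ; zero; suc; _+_; _*_; _∸_; _≤ᵇ_; _<ᵇ_; _≡ᵇ_)
open import Data.Bool using (Bool; true; false; if_then_else_; _∧_)
open import Data.Nat.ListAction using (sum)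
open import Data.List using (List; []; _∷_; _++_; take; map; upTo; replicate; length)
open import Data.Maybe using (Maybe; just; nothing)
open import Data.Product using (∃)
open import Relation.Binary.PropositionalEquality using (_≡_)

-- A (raw) vec-k path N^{k_1}E^{a_1}...N^{k_n}E^{a_n} is given by the two
-- lists ks = (k_1,...,k_n) and as = (a_1,...,a_n).

psum : List ℕ → ℕ → ℕ
psum xs t = sum (take t xs)

-- red ranks r_j = Σ_{i<j} (k_i - a_i), j = 1..n  (for Dyck paths the partial
-- sums satisfy psum as ≤ psum ks, so truncated subtraction is exact)
redRanks : List ℕ → List ℕ → List ℕ
redRanks ks as = map (λ j → psum ks j ∸ psum as j) (upTo (length ks))

area : List ℕ → List ℕ → ℕ
area ks as = sum (redRanks ks as)

-- index t (1-based) of the block E^{a_t} containing the east step starting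
-- at x-coordinate x, i.e. the least t with a_1+...+a_t > x.
firstExceed : List ℕ → ℕ → ℕ
firstExceed [] x = 0
firstExceed (a ∷ as) x = if x <ᵇ a then 1 else suc (firstExceed as (x ∸ a))

-- number of filled cells of R containing e; fs = fill times of the filled
-- columns (leftmost first), column c filled at time f holds f, f+1, ..., f+k_c
cellsWith : ℕ → List ℕ → List ℕ → ℕ
cellsWith e (f ∷ fs) (k ∷ ks) =
  (if (f ≤ᵇ e) ∧ (e ≤ᵇ f + k) then 1 else 0) + cellsWith e fs ks
cellsWith e _ _ = 0

-- The Xin–Zhang bounce algorithm, run with a fuel bound.
-- State: i (step), x = x(P_i), s (P_i has y-coordinate k_1+...+k_s, and
-- exactly s columns of R are filled), fs (fill times), acc = Σ i v_i so far.
bounceRun : ℕ → List ℕ → List ℕ → ℕ → ℕ → ℕ → List ℕ → ℕ → Maybe ℕ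
bounceRun zero ks as i x s fs acc = nothing
bounceRun (suc fuel) ks as i x s fs acc =
  if (x ≡ᵇ sum ks) ∧ (psum ks s ≡ᵇ sum ks) then just acc
  else (if x <ᵇ sum ks then step else nothing)
  where
  t = firstExceed as x
  v = t ∸ s
  fs' = fs ++ replicate v i
  h = cellsWith (suc i) fs' ks
  step : Maybe ℕ
  step = if t <ᵇ s then nothing
         else bounceRun fuel ks as (suc i) (x + h) t fs' (acc + i * v)

BounceIs : List ℕ → List ℕ → ℕ → Set
BounceIs ks as b = ∃ λ fuel → bounceRun fuel ks as 0 0 0 [] 0 ≡ just b

-- While x(P_i) < A the next east step lies in one of the first j blocks, so the
-- bounce algorithm only consults k_1, …, k_j and a_1, …, a_j and both paths pass
-- through the same states. Once x(P_i) ≥ A the next east step lies in the last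
-- block: that step fills all remaining columns at once, contributing i(j + 1 − s),
-- and afterwards no new column is ever filled, so the bounce sum is frozen. The run
-- terminates because x(P_i) strictly increases: on a path above the diagonal some
-- filled column always contains the entry i + 1. The area is untouched as well,
-- since the red ranks r_1, …, r_{j+1} never see the last block.
module Submission where

open import Defs
open import Data.Bool using (true; false; if_then_else_; _∧_)
open import Data.Empty using (⊥-elim)
open import Data.Nat
open import Data.Nat.Properties
open import Data.Nat.ListAction using (sum)
open import Data.Nat.ListAction.Properties using (sum-++)
open import Data.List using (List; []; _∷_; _++_; _∷ʳ_; length; replicate; map; upTo)
open import Data.List.Properties using (length-++; length-replicate; take-all; map-cong-local)
open import Data.List.Relation.Unary.All as All using (All; []; _∷_)
open import Data.List.Relation.Unary.All.Properties using (++⁺; replicate⁺; all-upTo)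
open import Data.Maybe using (Maybe; just)
open import Data.Product using (_×_; _,_; ∃)
open import Relation.Nullary using (yes; no)
open import Relation.Nullary.Reflects using (Reflects; ofʸ; ofⁿ; det; fromEquivalence)
open import Relation.Binary.PropositionalEquality
open import Algebra.Properties.CommutativeSemigroup +-commutativeSemigroup using (interchange)

<ᵇ-true : ∀ {m n} → m < n → (m <ᵇ n) ≡ true
<ᵇ-true {m} {n} m<n = det (<ᵇ-reflects-< m n) (ofʸ m<n)

<ᵇ-false : ∀ {m n} → n ≤ m → (m <ᵇ n) ≡ false
<ᵇ-false {m} {n} n≤m = det (<ᵇ-reflects-< m n) (ofⁿ (≤⇒≯ n≤m))

≤ᵇ-true : ∀ {m n} → m ≤ n → (m ≤ᵇ n) ≡ true
≤ᵇ-true {m} {n} m≤n = det (≤ᵇ-reflects-≤ m n) (ofʸ m≤n)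

≤ᵇ-false : ∀ {m n} → n < m → (m ≤ᵇ n) ≡ false
≤ᵇ-false {m} {n} n<m = det (≤ᵇ-reflects-≤ m n) (ofⁿ (<⇒≱ n<m))

≡ᵇ-reflects-≡ : ∀ m n → Reflects (m ≡ n) (m ≡ᵇ n)
≡ᵇ-reflects-≡ m n = fromEquivalence (≡ᵇ⇒≡ m n) (≡⇒≡ᵇ m n)

≡ᵇ-true : ∀ {m n} → m ≡ n → (m ≡ᵇ n) ≡ true
≡ᵇ-true {m} {n} m≡n = det (≡ᵇ-reflects-≡ m n) (ofʸ m≡n)

≡ᵇ-false : ∀ {m n} → m ≢ n → (m ≡ᵇ n) ≡ false
≡ᵇ-false {m} {n} m≢n = det (≡ᵇ-reflects-≡ m n) (ofⁿ m≢n)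

n<m+o⇒n∸m<o : ∀ {m n o} → m ≤ n → n < m + o → n ∸ m < o
n<m+o⇒n∸m<o {m} {n} {o} m≤n n<m+o = subst (n ∸ m <_) (m+n∸m≡n m o) (∸-monoˡ-< n<m+o m≤n)

m≤n+1+o⇒n<p⇒m≤p+o : ∀ {m n o p} → m ≤ n + suc o → n < p → m ≤ p + o
m≤n+1+o⇒n<p⇒m≤p+o {n = n} {o} m≤n+1+o n<p =
  ≤-trans m≤n+1+o (≤-trans (≤-reflexive (+-suc n o)) (+-monoˡ-≤ o n<p))

length-∷ʳ : ∀ (xs : List ℕ) x → length (xs ∷ʳ x) ≡ suc (length xs)
length-∷ʳ xs x = trans (length-++ xs) (+-comm (length xs) 1)

sum-∷ʳ : ∀ xs x → sum (xs ∷ʳ x) ≡ sum xs + x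
sum-∷ʳ xs x = trans (sum-++ xs (x ∷ [])) (cong (sum xs +_) (+-identityʳ x))

psum-++ˡ : ∀ xs ys {t} → t ≤ length xs → psum (xs ++ ys) t ≡ psum xs t
psum-++ˡ xs       ys {zero}  _          = refl
psum-++ˡ (x ∷ xs) ys {suc t} (s≤s t≤n) = cong (x +_) (psum-++ˡ xs ys t≤n)

psum-≥length : ∀ xs {t} → length xs ≤ t → psum xs t ≡ sum xs
psum-≥length xs {t} n≤t = cong sum (take-all t xs n≤t)

psum≤sum : ∀ xs t → psum xs t ≤ sum xs
psum≤sum []       zero    = z≤n
psum≤sum []       (suc t) = z≤n
psum≤sum (x ∷ xs) zero    = z≤n
psum≤sum (x ∷ xs) (suc t) = +-monoʳ-≤ x (psum≤sum xs t)

AboveDiagonal : List ℕ → List ℕ → Set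
AboveDiagonal ks as = ∀ t → psum as t ≤ psum ks t

aboveDiagonal⇒sum≤ : ∀ {ks as} → length as ≡ length ks → AboveDiagonal ks as → sum as ≤ sum ks
aboveDiagonal⇒sum≤ {ks} {as} same-length above =
  subst₂ _≤_ (psum-≥length as (≤-reflexive same-length)) (psum-≥length ks ≤-refl) (above (length ks))

aboveDiagonal-∷ʳ : ∀ {ks as} l c → length as ≡ length ks → sum (as ∷ʳ c) ≡ sum (ks ∷ʳ l) →
  AboveDiagonal ks as → AboveDiagonal (ks ∷ʳ l) (as ∷ʳ c)
aboveDiagonal-∷ʳ {ks} {as} l c same-length total above t with t ≤? length ks
... | yes t≤n = subst₂ _≤_ (sym (psum-++ˡ as _ (subst (t ≤_) (sym same-length) t≤n)))
                           (sym (psum-++ˡ ks _ t≤n)) (above t)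
... | no t≰n = subst₂ _≤_ (sym (psum-≥length (as ∷ʳ c) (length≤t as same-length)))
                          (sym (psum-≥length (ks ∷ʳ l) (length≤t ks refl))) (≤-reflexive total)
  where
  length≤t : ∀ xs {y} → length xs ≡ length ks → length (xs ∷ʳ y) ≤ t
  length≤t xs {y} eq = subst (_≤ t) (sym (trans (length-∷ʳ xs y) (cong suc eq))) (≰⇒> t≰n)

firstExceed-< : ∀ {a x} as → x < a → firstExceed (a ∷ as) x ≡ 1
firstExceed-< _ x<a rewrite <ᵇ-true x<a = refl

firstExceed-≥ : ∀ {a x} as → a ≤ x → firstExceed (a ∷ as) x ≡ suc (firstExceed as (x ∸ a))
firstExceed-≥ _ a≤x rewrite <ᵇ-false a≤x = refl

firstExceed≤length : ∀ as x → firstExceed as x ≤ length as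
firstExceed≤length []       x = z≤n
firstExceed≤length (a ∷ as) x with x <? a
... | yes x<a rewrite firstExceed-< as x<a = s≤s z≤n
... | no x≮a rewrite firstExceed-≥ as (≮⇒≥ x≮a) = s≤s (firstExceed≤length as (x ∸ a))

firstExceed-mono : ∀ as {x y} → x ≤ y → firstExceed as x ≤ firstExceed as y
firstExceed-mono []       x≤y = z≤n
firstExceed-mono (a ∷ as) {x} {y} x≤y with x <? a | y <? a
... | yes x<a | yes y<a rewrite firstExceed-< as x<a | firstExceed-< as y<a = ≤-refl
... | yes x<a | no y≮a  rewrite firstExceed-< as x<a | firstExceed-≥ as (≮⇒≥ y≮a) = s≤s z≤n
... | no x≮a  | yes y<a = ⊥-elim (x≮a (≤-<-trans x≤y y<a))
... | no x≮a  | no y≮a  rewrite firstExceed-≥ as (≮⇒≥ x≮a) | firstExceed-≥ as (≮⇒≥ y≮a) =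
  s≤s (firstExceed-mono as (∸-monoˡ-≤ a x≤y))

<psum-firstExceed : ∀ as x → x < sum as → x < psum as (firstExceed as x)
<psum-firstExceed (a ∷ as) x x<sum with x <? a
... | yes x<a rewrite firstExceed-< as x<a = ≤-trans x<a (m≤m+n a 0)
... | no x≮a rewrite firstExceed-≥ as (≮⇒≥ x≮a) =
  subst (_< a + psum as (firstExceed as (x ∸ a))) (m+[n∸m]≡n (≮⇒≥ x≮a))
    (+-monoʳ-< a (<psum-firstExceed as (x ∸ a) (n<m+o⇒n∸m<o (≮⇒≥ x≮a) x<sum)))

firstExceed-++ : ∀ as ys {x} → x < sum as → firstExceed (as ++ ys) x ≡ firstExceed as x
firstExceed-++ (a ∷ as) ys {x} x<sum with x <? a
... | yes x<a rewrite firstExceed-< as x<a | firstExceed-< (as ++ ys) x<a = refl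
... | no x≮a rewrite firstExceed-≥ as (≮⇒≥ x≮a) | firstExceed-≥ (as ++ ys) (≮⇒≥ x≮a) =
  cong suc (firstExceed-++ as ys (n<m+o⇒n∸m<o (≮⇒≥ x≮a) x<sum))

firstExceed≤firstExceed-++ : ∀ as ys x → firstExceed as x ≤ firstExceed (as ++ ys) x
firstExceed≤firstExceed-++ []       ys x = z≤n
firstExceed≤firstExceed-++ (a ∷ as) ys x with x <? a
... | yes x<a rewrite firstExceed-< as x<a | firstExceed-< (as ++ ys) x<a = ≤-refl
... | no x≮a rewrite firstExceed-≥ as (≮⇒≥ x≮a) | firstExceed-≥ (as ++ ys) (≮⇒≥ x≮a) =
  s≤s (firstExceed≤firstExceed-++ as ys (x ∸ a))

firstExceed-∷ʳ : ∀ as {c x} → sum as ≤ x → x < sum as + c → firstExceed (as ∷ʳ c) x ≡ suc (length as)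
firstExceed-∷ʳ []       _     x<c = firstExceed-< [] x<c
firstExceed-∷ʳ (a ∷ as) {c} {x} A≤x x<A+c
  rewrite firstExceed-≥ (as ∷ʳ c) (≤-trans (m≤m+n a (sum as)) A≤x) =
  cong suc (firstExceed-∷ʳ as
    (subst (_≤ x ∸ a) (m+n∸m≡n a (sum as)) (∸-monoˡ-≤ a A≤x))
    (n<m+o⇒n∸m<o (≤-trans (m≤m+n a (sum as)) A≤x) (subst (x <_) (+-assoc a (sum as) c) x<A+c)))

-- Column c of R, filled at time f, holds f, f + 1, …, f + k_c; exactly k_c ⊓ (e ∸ f)
-- of its cells hold an entry in f + 1, …, e. Summed over the filled columns this is
-- x(P_e), since x(P_{i+1}) = x(P_i) + h_i.
lowerCells : ℕ → List ℕ → List ℕ → ℕ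
lowerCells e (f ∷ fs) (k ∷ ks) = k ⊓ (e ∸ f) + lowerCells e fs ks
lowerCells e _        _        = 0

lowerCells-++-replicate : ∀ e fs v ks → lowerCells e (fs ++ replicate v e) ks ≡ lowerCells e fs ks
lowerCells-++-replicate e []       zero    ks       = refl
lowerCells-++-replicate e []       (suc v) []       = refl
lowerCells-++-replicate e []       (suc v) (k ∷ ks) rewrite n∸n≡0 e | ⊓-zeroʳ k =
  lowerCells-++-replicate e [] v ks
lowerCells-++-replicate e (f ∷ fs) v       []       = refl
lowerCells-++-replicate e (f ∷ fs) v       (k ∷ ks) = cong (k ⊓ (e ∸ f) +_) (lowerCells-++-replicate e fs v ks)

column-suc : ∀ {f e} k → f ≤ e →
  k ⊓ (suc e ∸ f) ≡ k ⊓ (e ∸ f) + (if (f ≤ᵇ suc e) ∧ (suc e ≤ᵇ f + k) then 1 else 0)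
column-suc {f} k f≤e with m≤n⇒∃[o]m+o≡n f≤e
... | d , refl rewrite sym (+-suc f d) | m+n∸m≡n f (suc d) | m+n∸m≡n f d | ≤ᵇ-true (m≤m+n f (suc d))
  with d <? k
...   | yes d<k rewrite <ᵇ-true (+-monoʳ-< f d<k) | m≥n⇒m⊓n≡n d<k | m≥n⇒m⊓n≡n (<⇒≤ d<k) = +-comm 1 d
...   | no d≮k rewrite <ᵇ-false (+-monoʳ-≤ f (≮⇒≥ d≮k))
                     | m≤n⇒m⊓n≡m (m≤n⇒m≤1+n (≮⇒≥ d≮k)) | m≤n⇒m⊓n≡m (≮⇒≥ d≮k) = sym (+-identityʳ k)

lowerCells-suc : ∀ e fs ks → All (_≤ e) fs →
  lowerCells (suc e) fs ks ≡ lowerCells e fs ks + cellsWith (suc e) fs ks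
lowerCells-suc e []       ks       _            = refl
lowerCells-suc e (f ∷ fs) []       _            = refl
lowerCells-suc e (f ∷ fs) (k ∷ ks) (f≤e ∷ fs≤e)
  rewrite column-suc k f≤e | lowerCells-suc e fs ks fs≤e = interchange (k ⊓ (e ∸ f)) _ _ _

lowerCells≤psum : ∀ e fs ks → lowerCells e fs ks ≤ psum ks (length fs)
lowerCells≤psum e []       ks       = z≤n
lowerCells≤psum e (f ∷ fs) []       = z≤n
lowerCells≤psum e (f ∷ fs) (k ∷ ks) = +-mono-≤ (m⊓n≤m k _) (lowerCells≤psum e fs ks)

lowerCells-full : ∀ e fs ks → All (_≤ e) fs → cellsWith e fs ks ≡ 0 →
  lowerCells e fs ks ≡ psum ks (length fs)
lowerCells-full e []       ks       _            _       = refl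
lowerCells-full e (f ∷ fs) []       _            _       = refl
lowerCells-full e (f ∷ fs) (k ∷ ks) (f≤e ∷ fs≤e) noCells rewrite ≤ᵇ-true f≤e with e ≤? f + k
... | yes e≤f+k rewrite ≤ᵇ-true e≤f+k = ⊥-elim (1+n≢0 noCells)
... | no e≰f+k rewrite ≤ᵇ-false (≰⇒> e≰f+k) =
  cong₂ _+_ (m≤n⇒m⊓n≡m k≤e∸f) (lowerCells-full e fs ks fs≤e noCells)
  where
  k≤e∸f : k ≤ e ∸ f
  k≤e∸f = subst (_≤ e ∸ f) (m+n∸m≡n f k) (∸-monoˡ-≤ f (<⇒≤ (≰⇒> e≰f+k)))

lowerCells-++ : ∀ e fs ks ys → length fs ≤ length ks → lowerCells e fs (ks ++ ys) ≡ lowerCells e fs ks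
lowerCells-++ e []       ks       ys _         = refl
lowerCells-++ e (f ∷ fs) (k ∷ ks) ys (s≤s len) = cong (k ⊓ (e ∸ f) +_) (lowerCells-++ e fs ks ys len)

cellsWith-++ : ∀ e fs ks ys → length fs ≤ length ks → cellsWith e fs (ks ++ ys) ≡ cellsWith e fs ks
cellsWith-++ e []       ks       ys _         = refl
cellsWith-++ e (f ∷ fs) (k ∷ ks) ys (s≤s len) = cong (_ +_) (cellsWith-++ e fs ks ys len)

record State : Set where
  constructor state
  field
    xcoord    : ℕ
    filled    : ℕ
    fillTimes : List ℕ
    bounceSum : ℕ
open State

initial : State
initial = state 0 0 [] 0

run : ℕ → List ℕ → List ℕ → ℕ → State → Maybe ℕ
run fuel ks as i (state x s fs b) = bounceRun fuel ks as i x s fs b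

Returns : List ℕ → List ℕ → ℕ → State → ℕ → Set
Returns ks as i st r = ∃ λ fuel → run fuel ks as i st ≡ just r

step : List ℕ → List ℕ → ℕ → State → State
step ks as i (state x s fs b) = state (x + cellsWith (suc i) fs′ ks) t fs′ (b + i * (t ∸ s))
  where
  t = firstExceed as x
  fs′ = fs ++ replicate (t ∸ s) i

run-suc : ∀ {ks as i fuel} st → xcoord st < sum ks → filled st ≤ firstExceed as (xcoord st) →
  run (suc fuel) ks as i st ≡ run fuel ks as (suc i) (step ks as i st)
run-suc (state x s fs b) x<K s≤t rewrite ≡ᵇ-false (<⇒≢ x<K) | <ᵇ-true x<K | <ᵇ-false s≤t = refl

run-stop : ∀ {ks as i} st → xcoord st ≡ sum ks → psum ks (filled st) ≡ sum ks →
  run 1 ks as i st ≡ just (bounceSum st)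
run-stop (state x s fs b) x≡K psum≡K rewrite ≡ᵇ-true x≡K | ≡ᵇ-true psum≡K = refl

returns-step : ∀ {ks as i r} st → xcoord st < sum ks → filled st ≤ firstExceed as (xcoord st) →
  Returns ks as (suc i) (step ks as i st) r → Returns ks as i st r
returns-step {ks} {as} {i} st x<K s≤t (fuel , ran) =
  suc fuel , trans (run-suc {ks} {as} {i} {fuel} st x<K s≤t) ran

returns-stop : ∀ {ks as i} st → xcoord st ≡ sum ks → psum ks (filled st) ≡ sum ks →
  Returns ks as i st (bounceSum st)
returns-stop {ks} {as} {i} st x≡K psum≡K = 1 , run-stop {ks} {as} {i} st x≡K psum≡K

record Invariant (ks as : List ℕ) (i : ℕ) (st : State) : Set where
  field
    filled-earlier : All (_< i) (fillTimes st)
    xcoord-lower   : xcoord st ≡ lowerCells i (fillTimes st) ks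
    length-fills   : length (fillTimes st) ≡ filled st
    filled≤next    : filled st ≤ firstExceed as (xcoord st)
open Invariant

invariant-initial : ∀ {ks as} → Invariant ks as 0 initial
invariant-initial = record
  { filled-earlier = [] ; xcoord-lower = refl ; length-fills = refl ; filled≤next = z≤n }

module _ {ks as : List ℕ} {i : ℕ} {st : State} (inv : Invariant ks as i st) where

  filled≤length : filled st ≤ length as
  filled≤length = ≤-trans (filled≤next inv) (firstExceed≤length as (xcoord st))

  xcoord≤psum : xcoord st ≤ psum ks (filled st)
  xcoord≤psum = subst₂ _≤_ (sym (xcoord-lower inv)) (cong (psum ks) (length-fills inv))
                  (lowerCells≤psum i (fillTimes st) ks)

  returns-at-end : sum ks ≤ xcoord st → Returns ks as i st (bounceSum st)
  returns-at-end K≤x = returns-stop st x≡K psum≡K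
    where
    x≤K : xcoord st ≤ sum ks
    x≤K = ≤-trans xcoord≤psum (psum≤sum ks (filled st))
    x≡K : xcoord st ≡ sum ks
    x≡K = ≤-antisym x≤K K≤x
    psum≡K : psum ks (filled st) ≡ sum ks
    psum≡K = ≤-antisym (psum≤sum ks (filled st)) (subst (_≤ psum ks (filled st)) x≡K xcoord≤psum)

  private
    x = xcoord st
    t = firstExceed as x
    fs′ = fillTimes st ++ replicate (t ∸ filled st) i
    h = cellsWith (suc i) fs′ ks

    length-fs′ : length fs′ ≡ t
    length-fs′ = trans (length-++ (fillTimes st))
                   (trans (cong₂ _+_ (length-fills inv) (length-replicate (t ∸ filled st)))
                          (m+[n∸m]≡n (filled≤next inv)))

    fs′≤i : All (_≤ i) fs′
    fs′≤i = ++⁺ (All.map <⇒≤ (filled-earlier inv)) (replicate⁺ (t ∸ filled st) ≤-refl)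

    lowerCells-step : lowerCells (suc i) fs′ ks ≡ x + h
    lowerCells-step = begin
      lowerCells (suc i) fs′ ks                  ≡⟨ lowerCells-suc i fs′ ks fs′≤i ⟩
      lowerCells i fs′ ks + h                    ≡⟨ cong (_+ h) (lowerCells-++-replicate i (fillTimes st) _ ks) ⟩
      lowerCells i (fillTimes st) ks + h         ≡⟨ cong (_+ h) (sym (xcoord-lower inv)) ⟩
      x + h                                      ∎
      where open ≡-Reasoning

  step-invariant : Invariant ks as (suc i) (step ks as i st)
  step-invariant = record
    { filled-earlier = All.map s≤s fs′≤i
    ; xcoord-lower   = sym lowerCells-step
    ; length-fills   = length-fs′
    ; filled≤next    = firstExceed-mono as (m≤m+n x h)
    }

  -- If no filled column contained i + 1, all of them would be exhausted and
  -- x(P_i) = k_1 + ⋯ + k_t, contradicting x(P_i) < a_1 + ⋯ + a_t.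
  step-advances : AboveDiagonal ks as → x < sum as → x < xcoord (step ks as i st)
  step-advances above x<A = subst (_< x + h) (+-identityʳ x) (+-monoʳ-< x (n≢0⇒n>0 h≢0))
    where
    h≢0 : h ≢ 0
    h≢0 h≡0 = <-irrefl x≡psum (<-≤-trans (<psum-firstExceed as x x<A) (above t))
      where
      x≡psum : x ≡ psum ks t
      x≡psum = begin
        x                          ≡⟨ sym (+-identityʳ x) ⟩
        x + 0                      ≡⟨ cong (x +_) (sym h≡0) ⟩
        x + h                      ≡⟨ sym lowerCells-step ⟩
        lowerCells (suc i) fs′ ks  ≡⟨ lowerCells-full (suc i) fs′ ks (All.map m≤n⇒m≤1+n fs′≤i) h≡0 ⟩
        psum ks (length fs′)       ≡⟨ cong (psum ks) length-fs′ ⟩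
        psum ks t                  ∎
        where open ≡-Reasoning

  step-++ : ∀ ys zs → length as ≤ length ks → x < sum as → step (ks ++ ys) (as ++ zs) i st ≡ step ks as i st
  step-++ ys zs as≤ks x<A rewrite firstExceed-++ as zs x<A =
    cong (λ h′ → state (x + h′) t fs′ (bounceSum st + i * (t ∸ filled st)))
      (cellsWith-++ (suc i) fs′ ks ys (subst (_≤ length ks) (sym length-fs′)
        (≤-trans (firstExceed≤length as x) as≤ks)))

  invariant-++ : ∀ ys zs → length as ≤ length ks → Invariant (ks ++ ys) (as ++ zs) i st
  invariant-++ ys zs as≤ks = record
    { filled-earlier = filled-earlier inv
    ; xcoord-lower   = trans (xcoord-lower inv) (sym (lowerCells-++ i (fillTimes st) ks ys
                         (subst (_≤ length ks) (sym (length-fills inv)) (≤-trans filled≤length as≤ks))))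
    ; length-fills   = length-fills inv
    ; filled≤next    = ≤-trans (filled≤next inv) (firstExceed≤firstExceed-++ as zs x)
    }

returns-saturated : ∀ {ks as i} → AboveDiagonal ks as → sum as ≡ sum ks → ∀ n st →
  sum ks ≤ xcoord st + n → Invariant ks as i st → length as ≤ filled st → Returns ks as i st (bounceSum st)
returns-saturated above total zero st bound inv _ =
  returns-at-end inv (subst (_ ≤_) (+-identityʳ (xcoord st)) bound)
returns-saturated {ks} {as} {i} above total (suc n) st bound inv full with xcoord st <? sum ks
... | no x≮K = returns-at-end inv (≮⇒≥ x≮K)
... | yes x<K = returns-step st x<K (filled≤next inv)
      (subst (Returns ks as (suc i) (step ks as i st)) no-new-column
        (returns-saturated above total n (step ks as i st)
          (m≤n+1+o⇒n<p⇒m≤p+o bound (step-advances inv above (subst (_ <_) (sym total) x<K)))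
          (step-invariant inv) (≤-trans full (filled≤next inv))))
  where
  no-new-column : bounceSum st + i * (firstExceed as (xcoord st) ∸ filled st) ≡ bounceSum st
  no-new-column rewrite m≤n⇒m∸n≡0 (≤-trans (firstExceed≤length as (xcoord st)) full) | *-zeroʳ i =
    +-identityʳ (bounceSum st)

returns-lastBlock : ∀ {ks as i st} → AboveDiagonal ks as → sum as ≡ sum ks → Invariant ks as i st →
  xcoord st < sum ks → length as ≤ firstExceed as (xcoord st) →
  Returns ks as i st (bounceSum (step ks as i st))
returns-lastBlock {ks} {as} {i} {st} above total inv x<K last =
  returns-step st x<K (filled≤next inv)
    (returns-saturated above total (sum ks) (step ks as i st) (m≤n+m _ _) (step-invariant inv) last)

module Extension (ks as : List ℕ) (same-length : length as ≡ length ks) (above : AboveDiagonal ks as) where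

  finalEast : ℕ → ℕ
  finalEast l = sum ks + l ∸ sum as

  sum-∷ʳ-finalEast : ∀ l → sum (as ∷ʳ finalEast l) ≡ sum (ks ∷ʳ l)
  sum-∷ʳ-finalEast l = begin
    sum (as ∷ʳ finalEast l)  ≡⟨ sum-∷ʳ as (finalEast l) ⟩
    sum as + finalEast l     ≡⟨ m+[n∸m]≡n (≤-trans (aboveDiagonal⇒sum≤ same-length above) (m≤m+n (sum ks) l)) ⟩
    sum ks + l               ≡⟨ sym (sum-∷ʳ ks l) ⟩
    sum (ks ∷ʳ l)            ∎
    where open ≡-Reasoning

  module _ {i : ℕ} {st : State} (inv : Invariant ks as i st) (l : ℕ) where

    invariant-∷ʳ : Invariant (ks ∷ʳ l) (as ∷ʳ finalEast l) i st
    invariant-∷ʳ = invariant-++ inv (l ∷ []) (finalEast l ∷ []) (≤-reflexive same-length)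

    xcoord<sum-∷ʳ : 1 ≤ l → xcoord st < sum (ks ∷ʳ l)
    xcoord<sum-∷ʳ l≥1 = subst (xcoord st <_) (sym (sum-∷ʳ ks l))
      (≤-<-trans (≤-trans (xcoord≤psum inv) (psum≤sum ks (filled st))) (m<m+n (sum ks) l≥1))

    returns-after-prefix : 1 ≤ l → sum as ≤ xcoord st →
      Returns (ks ∷ʳ l) (as ∷ʳ finalEast l) i st (bounceSum st + i * (suc (length as) ∸ filled st))
    returns-after-prefix l≥1 A≤x =
      subst (Returns (ks ∷ʳ l) (as ∷ʳ finalEast l) i st) (cong (λ t → bounceSum st + i * (t ∸ filled st)) last)
        (returns-lastBlock (aboveDiagonal-∷ʳ l (finalEast l) same-length (sum-∷ʳ-finalEast l) above)
          (sum-∷ʳ-finalEast l) invariant-∷ʳ (xcoord<sum-∷ʳ l≥1)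
          (≤-reflexive (trans (length-∷ʳ as (finalEast l)) (sym last))))
      where
      last : firstExceed (as ∷ʳ finalEast l) (xcoord st) ≡ suc (length as)
      last = firstExceed-∷ʳ as A≤x
        (subst (xcoord st <_) (trans (sym (sum-∷ʳ-finalEast l)) (sum-∷ʳ as (finalEast l))) (xcoord<sum-∷ʳ l≥1))

  returns-∷ʳ : ∀ n {i} st → sum as ≤ xcoord st + n → Invariant ks as i st →
    ∃ λ r → ∀ l → 1 ≤ l → Returns (ks ∷ʳ l) (as ∷ʳ finalEast l) i st r
  returns-∷ʳ zero st bound inv =
    _ , λ l l≥1 → returns-after-prefix inv l l≥1 (subst (_ ≤_) (+-identityʳ (xcoord st)) bound)
  returns-∷ʳ (suc n) {i} st bound inv with xcoord st <? sum as
  ... | no x≮A = _ , λ l l≥1 → returns-after-prefix inv l l≥1 (≮⇒≥ x≮A)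
  ... | yes x<A =
    let r , returns = returns-∷ʳ n (step ks as i st)
                        (m≤n+1+o⇒n<p⇒m≤p+o bound (step-advances inv above x<A)) (step-invariant inv)
    in r , λ l l≥1 →
      returns-step st (xcoord<sum-∷ʳ inv l l≥1) (filled≤next (invariant-∷ʳ inv l))
        (subst (λ st′ → Returns (ks ∷ʳ l) (as ∷ʳ finalEast l) (suc i) st′ r)
          (sym (step-++ inv (l ∷ []) (finalEast l ∷ []) (≤-reflexive same-length) x<A)) (returns l l≥1))

redRanks-∷ʳ : ∀ ks as l c → length as ≡ length ks →
  redRanks (ks ∷ʳ l) (as ∷ʳ c) ≡ map (λ t → psum ks t ∸ psum as t) (upTo (suc (length ks)))
redRanks-∷ʳ ks as l c same-length rewrite length-∷ʳ ks l =
  map-cong-local (All.map (λ t<n → cong₂ _∸_ (psum-++ˡ ks _ (≤-pred t<n))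
                                            (psum-++ˡ as _ (subst (_ ≤_) (sym same-length) (≤-pred t<n))))
                          (all-upTo (suc (length ks))))

aboveDiagonal-intro : ∀ ks as → 1 ≤ length ks → length as ≡ length ks →
  (∀ t → 1 ≤ t → t ≤ length ks → psum as t ≤ psum ks t) → AboveDiagonal ks as
aboveDiagonal-intro ks as n≥1 same-length dyck zero    = z≤n
aboveDiagonal-intro ks as n≥1 same-length dyck (suc t) with suc t ≤? length ks
... | yes t≤n = dyck (suc t) (s≤s z≤n) t≤n
... | no t≰n = subst₂ _≤_ (trans (psum-≥length as (≤-reflexive same-length)) (sym (psum-≥length as as≤t)))
                          (trans (psum-≥length ks ≤-refl) (sym (psum-≥length ks ks≤t)))
                          (dyck (length ks) n≥1 ≤-refl)
  where
  ks≤t : length ks ≤ suc t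
  ks≤t = <⇒≤ (≰⇒> t≰n)
  as≤t : length as ≤ suc t
  as≤t = subst (_≤ suc t) (sym same-length) ks≤t

proposition6p1 : (j : ℕ) → 1 ≤ j → (ks as : List ℕ) → length ks ≡ j → length as ≡ j →
    All (1 ≤_) ks → (∀ i → 1 ≤ i → i ≤ j → psum as i ≤ psum ks i) →
    (l m : ℕ) → 1 ≤ l → 1 ≤ m →
    area (ks ++ l ∷ []) (as ++ (sum ks + l ∸ sum as) ∷ []) ≡ area (ks ++ m ∷ []) (as ++ (sum ks + m ∸ sum as) ∷ [])
    × ∃ λ b → BounceIs (ks ++ l ∷ []) (as ++ (sum ks + l ∸ sum as) ∷ []) b
    × BounceIs (ks ++ m ∷ []) (as ++ (sum ks + m ∸ sum as) ∷ []) b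
proposition6p1 j j≥1 ks as refl same-length _ dyck l m l≥1 m≥1 =
  let r , returns = returns-∷ʳ (sum as) initial (m≤n+m (sum as) 0) invariant-initial
  in  cong sum (trans (redRanks-∷ʳ ks as l _ same-length) (sym (redRanks-∷ʳ ks as m _ same-length)))
    , r , returns l l≥1 , returns m m≥1
  where
  open Extension ks as same-length (aboveDiagonal-intro ks as j≥1 same-length dyck)
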